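{- Let $v,d\ge0$. A DCF formula of $\mathcal{F}(v,d)$ is a theorem of $\mathbf{E}$ if and only if it is the disjunction of all the DCF minterms of $\mathcal{F}(v,d)$.
   Context: Language: propositional variables $p_1,p_2,\dots$, constants $0,1$, connectives $\neg,\vee,\wedge$, modal operator $\lozenge$. $\mathbf{E}$ is the smallest set of formulas containing all propositional tautologies and closed under modus ponens, uniform substitution and the rule RE: from $\varphi\leftrightarrow\psi$ infer $\lozenge\varphi\leftrightarrow\lozenge\psi$. $\mathcal{F}(v,d)$ is the set of formulas in variables among $p_1,\dots,p_v$ with $\lozenge$-nesting depth $\le d$. Disjunctive canonical forms (DCF), for fixed $v$, defined by recursion on $d$: a level-0 minterm is a conjunction $\pm p_1\wedge\dots\wedge\pm p_v$ (each variable plain or negated; for $v=0$ the single minterm is $1$); a DCF formula of $\mathcal{F}(v,0)$ is a disjunction of a set of distinct level-0 minterms (the empty disjunction being $0$). For $d\ge1$, the level-$d$ modal factors are the formulas $\lozenge\phi$ with $\phi$ ranging over all DCF formulas of $\mathcal{F}(v,d-1)$; a level-$d$ minterm (DCF minterm of $\mathcal{F}(v,d)$) is the conjunction of a level-0 minterm with all the level-$d$ modal factors, each occurring either plain or negated; a DCF formula of $\mathcal{F}(v,d)$ is a disjunction of a set of distinct level-$d$ minterms ($0$ if the set is empty). -}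

module Defs where

open import Data.Nat using (ℕ; zero; suc)
open import Data.Bool using (Bool; true; false; not; _∧_; _∨_)
open import Data.List using (List; []; _∷_; map; _++_; concatMap; length; zipWith; applyUpTo)
open import Relation.Binary.PropositionalEquality using (_≡_)

-- Formulas: variables p_i (var i, i : ℕ; p_1 is var 1), constants 0,1, ¬, ∨, ∧, ◇
data Formula : Set where
  var  : ℕ → Formula
  ⊥'   : Formula
  ⊤'   : Formula
  ¬'_  : Formula → Formula
  _∨'_ : Formula → Formula → Formula
  _∧'_ : Formula → Formula → Formula
  ◇_   : Formula → Formula

infixr 6 _∧'_
infixr 5 _∨'_
infix 7 ¬'_ ◇_

_⇒'_ : Formula → Formula → Formula
φ ⇒' ψ = ¬' φ ∨' ψ

_⇔'_ : Formula → Formula → Formula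
φ ⇔' ψ = (φ ⇒' ψ) ∧' (ψ ⇒' φ)

eval : (ℕ → Bool) → (Formula → Bool) → Formula → Bool
eval val w (var i)   = val i
eval val w ⊥'        = false
eval val w ⊤'        = true
eval val w (¬' φ)    = not (eval val w φ)
eval val w (φ ∨' ψ)  = eval val w φ ∨ eval val w ψ
eval val w (φ ∧' ψ)  = eval val w φ ∧ eval val w ψ
eval val w (◇ φ)     = w φ

Tautology : Formula → Set
Tautology φ = (val : ℕ → Bool) (w : Formula → Bool) → eval val w φ ≡ true

subst' : (ℕ → Formula) → Formula → Formula
subst' σ (var i)   = σ i
subst' σ ⊥'        = ⊥'
subst' σ ⊤'        = ⊤'
subst' σ (¬' φ)    = ¬' subst' σ φ
subst' σ (φ ∨' ψ)  = subst' σ φ ∨' subst' σ ψ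
subst' σ (φ ∧' ψ)  = subst' σ φ ∧' subst' σ ψ
subst' σ (◇ φ)     = ◇ subst' σ φ

data E : Formula → Set where
  taut : ∀ {φ} → Tautology φ → E φ
  mp   : ∀ {φ ψ} → E φ → E (φ ⇒' ψ) → E ψ
  us   : ∀ {φ} (σ : ℕ → Formula) → E φ → E (subst' σ φ)
  re   : ∀ {φ ψ} → E (φ ⇔' ψ) → E ((◇ φ) ⇔' (◇ ψ))

-- Disjunctive canonical forms (with a fixed canonical ordering)

⋀ : List Formula → Formula
⋀ []           = ⊤'
⋀ (φ ∷ [])     = φ
⋀ (φ ∷ ψ ∷ φs) = φ ∧' ⋀ (ψ ∷ φs)

⋁ : List Formula → Formula
⋁ []           = ⊥'
⋁ (φ ∷ [])     = φ
⋁ (φ ∷ ψ ∷ φs) = φ ∨' ⋁ (ψ ∷ φs)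

signs : ℕ → List (List Bool)
signs zero    = [] ∷ []
signs (suc n) = map (true ∷_) (signs n) ++ map (false ∷_) (signs n)

lit : Bool → Formula → Formula
lit true  φ = φ
lit false φ = ¬' φ

sublists : {A : Set} → List A → List (List A)
sublists []       = [] ∷ []
sublists (x ∷ xs) = map (x ∷_) (sublists xs) ++ sublists xs

vars : ℕ → List Formula
vars v = applyUpTo (λ i → var (suc i)) v

minterms0 : ℕ → List Formula
minterms0 v = map (λ s → ⋀ (zipWith lit s (vars v))) (signs v)

mutual
  minterms : ℕ → ℕ → List Formula
  minterms v zero    = minterms0 v
  minterms v (suc d) =
    concatMap (λ m₀ → map (λ s → ⋀ (m₀ ∷ zipWith lit s (map ◇_ (dcfs v d))))
                          (signs (length (dcfs v d))))
              (minterms0 v)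

  dcfs : ℕ → ℕ → List Formula
  dcfs v d = map ⋁ (sublists (minterms v d))

module Submission where

-- The disjunction of all minterms of depth d is a propositional tautology: under
-- any valuation the minterm whose signs record that valuation is true. Conversely,
-- E is sound for neighbourhood semantics, and in a suitable neighbourhood model the
-- worlds of depth d are the sign vectors of the minterms of depth d, each world
-- satisfying exactly its own minterm. A world of depth d + 1 makes ◇ψ true, for a
-- DCF ψ of depth d, according to its sign vector; this is consistent because
-- distinct DCFs of depth d have distinct truth sets among the worlds of depth d.
-- A DCF that is a theorem of E holds at every world of depth d, so it contains
-- every minterm.

open import Defs
open import Data.Nat using (ℕ; zero; suc; _+_; _∸_; _^_; _≤_; s≤s)
open import Data.Nat.Properties using (suc-injective; ≤-reflexive; ≤-trans; m≤m+n; m+n∸m≡n; m≤n⇒m⊓n≡m; +-identityʳ)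
open import Data.Bool using (Bool; true; false; not; _∧_; _∨_)
open import Data.Bool.Properties using (∧-assoc; ∧-identityʳ; ∨-zeroʳ; ∨-identityʳ)
open import Data.Bool.ListAction using (and; or)
open import Data.List using (List; []; _∷_; map; _++_; concat; concatMap; length; zipWith; applyUpTo; take; drop)
open import Data.List.Properties using (map-++; map-∘; map-cong; map-cong-local; map-id; length-map; length-++; length-take; length-drop; take-all; take++drop≡id; map-applyUpTo; length-applyUpTo; concatMap-map; map-concatMap; concatMap-++; concatMap-cong; ++-identityʳ)
open import Data.List.Relation.Unary.All as All using (All; []; _∷_)
open import Data.List.Relation.Unary.All.Properties using (map⁺; ++⁺)
open import Data.List.Relation.Unary.Any using (here; there)
open import Data.List.Membership.Propositional using (_∈_)
open import Data.List.Membership.Propositional.Properties using (∈-map⁺; ∈-map⁻; ∈-++⁺ˡ; ∈-++⁺ʳ)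
open import Data.Product using (_×_; _,_)
open import Function using (_∘_)
open import Relation.Binary.PropositionalEquality using (_≡_; refl; sym; trans; cong; cong₂; subst; module ≡-Reasoning)
open ≡-Reasoning

private
  variable
    A B : Set

infix 4 _≡ᵇ_

_≡ᵇ_ : Bool → Bool → Bool
true  ≡ᵇ b = b
false ≡ᵇ b = not b

-- Compares only the common prefix: lists of different lengths may agree.
agree : List Bool → List Bool → Bool
agree s t = and (zipWith _≡ᵇ_ s t)

agree-refl : ∀ s → agree s s ≡ true
agree-refl []          = refl
agree-refl (true  ∷ s) = agree-refl s
agree-refl (false ∷ s) = agree-refl s

agree-++ : ∀ s a c → agree s (a ++ c) ≡ agree (take (length a) s) a ∧ agree (drop (length a) s) c
agree-++ s       []      c = refl
agree-++ []      (_ ∷ _) c = refl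
agree-++ (x ∷ s) (y ∷ a) c =
  trans (cong ((x ≡ᵇ y) ∧_) (agree-++ s a c)) (sym (∧-assoc (x ≡ᵇ y) _ _))

or-++ : ∀ (a b : List Bool) → or (a ++ b) ≡ or a ∨ or b
or-++ []          b = refl
or-++ (true  ∷ a) b = refl
or-++ (false ∷ a) b = or-++ a b

true∈⇒or : ∀ {bs} → true ∈ bs → or bs ≡ true
true∈⇒or (here refl)         = refl
true∈⇒or {b ∷ _} (there t∈) = trans (cong (b ∨_) (true∈⇒or t∈)) (∨-zeroʳ b)

take-length-++ : ∀ (xs ys : List A) → take (length xs) (xs ++ ys) ≡ xs
take-length-++ []       ys = refl
take-length-++ (x ∷ xs) ys = cong (x ∷_) (take-length-++ xs ys)

drop-length-++ : ∀ (xs ys : List A) → drop (length xs) (xs ++ ys) ≡ ys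
drop-length-++ []       ys = refl
drop-length-++ (x ∷ xs) ys = drop-length-++ xs ys

length-take-+ : ∀ m {n} (xs : List A) → length xs ≡ m + n → length (take m xs) ≡ m
length-take-+ m xs p = trans (length-take m xs) (m≤n⇒m⊓n≡m (≤-trans (m≤m+n m _) (≤-reflexive (sym p))))

length-drop-+ : ∀ m {n} (xs : List A) → length xs ≡ m + n → length (drop m xs) ≡ n
length-drop-+ m xs p = trans (length-drop m xs) (trans (cong (_∸ m) p) (m+n∸m≡n m _))

select : List Bool → List A → List A
select _           []       = []
select []          (_ ∷ _)  = []
select (true  ∷ b) (x ∷ xs) = x ∷ select b xs
select (false ∷ b) (x ∷ xs) = select b xs

select-++ : ∀ {m} b (xs ys : List A) → length xs ≡ m →
  select b (xs ++ ys) ≡ select (take m b) xs ++ select (drop m b) ys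
select-++ b           []       ys      refl = refl
select-++ []          (x ∷ xs) []      refl = refl
select-++ []          (x ∷ xs) (_ ∷ _) refl = refl
select-++ (true  ∷ b) (x ∷ xs) ys      refl = cong (x ∷_) (select-++ b xs ys refl)
select-++ (false ∷ b) (x ∷ xs) ys      refl = select-++ b xs ys refl

map-select : ∀ (f : A → B) b xs → map f (select b xs) ≡ select b (map f xs)
map-select f _           []       = refl
map-select f []          (_ ∷ _)  = refl
map-select f (true  ∷ b) (x ∷ xs) = cong (f x ∷_) (map-select f b xs)
map-select f (false ∷ b) (x ∷ xs) = map-select f b xs

or-select-false : ∀ b (xs : List A) → or (select b (map (λ _ → false) xs)) ≡ false
or-select-false _           []       = refl
or-select-false []          (_ ∷ _)  = refl
or-select-false (true  ∷ b) (x ∷ xs) = or-select-false b xs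
or-select-false (false ∷ b) (x ∷ xs) = or-select-false b xs

or-select-∧ : ∀ a (f : A → Bool) b xs → or (select b (map (λ x → a ∧ f x) xs)) ≡ a ∧ or (select b (map f xs))
or-select-∧ true  f b xs = refl
or-select-∧ false f b xs = or-select-false b xs

select-all : ∀ {b} (xs : List A) → All (_≡ true) b → length b ≡ length xs → select b xs ≡ xs
select-all []       []          refl = refl
select-all (x ∷ xs) (refl ∷ bs) p    = cong (x ∷_) (select-all xs bs (suc-injective p))

signs-length : ∀ n → All (λ s → length s ≡ n) (signs n)
signs-length zero    = refl ∷ []
signs-length (suc n) = ++⁺ (prepend (signs-length n)) (prepend (signs-length n))
  where
  prepend : ∀ {x} → All (λ s → length s ≡ n) (signs n) → All (λ s → length s ≡ suc n) (map (x ∷_) (signs n))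
  prepend ls = map⁺ (All.map (cong suc) ls)

length-signs : ∀ n → length (signs n) ≡ 2 ^ n
length-signs zero    = refl
length-signs (suc n) = begin
  length (map (true ∷_) S ++ map (false ∷_) S)          ≡⟨ length-++ (map (true ∷_) S) ⟩
  length (map (true ∷_) S) + length (map (false ∷_) S)  ≡⟨ cong₂ _+_ (length-map _ S) (length-map _ S) ⟩
  length S + length S                                   ≡⟨ cong₂ _+_ (length-signs n) (trans (length-signs n) (sym (+-identityʳ _))) ⟩
  2 ^ n + (2 ^ n + 0)                                   ∎
  where S = signs n

∈-signs : ∀ s → s ∈ signs (length s)
∈-signs []          = here refl
∈-signs (true  ∷ s) = ∈-++⁺ˡ (∈-map⁺ (true ∷_) (∈-signs s))
∈-signs (false ∷ s) = ∈-++⁺ʳ (map (true ∷_) (signs (length s))) (∈-map⁺ (false ∷_) (∈-signs s))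

signs-+ : ∀ m n → signs (m + n) ≡ concatMap (λ a → map (a ++_) (signs n)) (signs m)
signs-+ zero    n = sym (trans (++-identityʳ _) (map-id (signs n)))
signs-+ (suc m) n = begin
  map (true ∷_) (signs (m + n)) ++ map (false ∷_) (signs (m + n))
    ≡⟨ cong (λ S → map (true ∷_) S ++ map (false ∷_) S) (signs-+ m n) ⟩
  map (true ∷_) (C (signs m)) ++ map (false ∷_) (C (signs m))
    ≡⟨ cong₂ _++_ (prepend true) (prepend false) ⟩
  C (map (true ∷_) (signs m)) ++ C (map (false ∷_) (signs m))
    ≡⟨ concatMap-++ F (map (true ∷_) (signs m)) _ ⟨
  C (signs (suc m)) ∎
  where
  F : List Bool → List (List Bool)
  F a = map (a ++_) (signs n)
  C : List (List Bool) → List (List Bool)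
  C = concatMap F
  prepend : ∀ x → map (x ∷_) (C (signs m)) ≡ C (map (x ∷_) (signs m))
  prepend x = begin
    map (x ∷_) (C (signs m))              ≡⟨ map-concatMap (x ∷_) F (signs m) ⟩
    concatMap (map (x ∷_) ∘ F) (signs m)  ≡⟨ concatMap-cong (λ a → map-∘ (signs n)) (signs m) ⟨
    concatMap (F ∘ (x ∷_)) (signs m)      ≡⟨ concatMap-map F (x ∷_) (signs m) ⟨
    C (map (x ∷_) (signs m))              ∎

sublists≡map-select : ∀ (xs : List A) → sublists xs ≡ map (λ b → select b xs) (signs (length xs))
sublists≡map-select []       = refl
sublists≡map-select (x ∷ xs) = begin
  map (x ∷_) (sublists xs) ++ sublists xs
    ≡⟨ cong (λ ys → map (x ∷_) ys ++ ys) (sublists≡map-select xs) ⟩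
  map (x ∷_) (map sel S) ++ map sel S
    ≡⟨ cong (_++ map sel S) (map-∘ S) ⟨
  map (λ b → x ∷ sel b) S ++ map sel S
    ≡⟨ cong₂ _++_ (map-∘ S) (map-∘ S) ⟩
  map sel′ (map (true ∷_) S) ++ map sel′ (map (false ∷_) S)
    ≡⟨ map-++ sel′ (map (true ∷_) S) _ ⟨
  map sel′ (signs (length (x ∷ xs))) ∎
  where
  S = signs (length xs)
  sel = λ b → select b xs
  sel′ = λ b → select b (x ∷ xs)

bit : List Bool → ℕ → Bool
bit []      _       = false
bit (x ∷ _) zero    = x
bit (_ ∷ k) (suc i) = bit k i

applyUpTo-bit : ∀ n k → n ≤ length k → applyUpTo (bit k) n ≡ take n k
applyUpTo-bit zero    k       _          = refl
applyUpTo-bit (suc n) (x ∷ k) (s≤s n≤k) = cong (x ∷_) (applyUpTo-bit n k n≤k)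

half : Bool → ℕ → List A → List A
half true  = take
half false = drop

length-half : ∀ x n (s : List A) → length s ≡ 2 ^ suc n → length (half x (2 ^ n) s) ≡ 2 ^ n
length-half true  n s p = length-take-+ (2 ^ n) s p
length-half false n s p = trans (length-drop-+ (2 ^ n) s p) (+-identityʳ _)

-- The entry of s at the position of k in signs (length k).
entry : List Bool → List Bool → Bool
entry s       (x ∷ k) = entry (half x (2 ^ length k) s) k
entry []      []      = false
entry (b ∷ _) []      = b

map-entry-signs : ∀ n s → length s ≡ 2 ^ n → map (entry s) (signs n) ≡ s
map-entry-signs zero    (b ∷ [])    refl = refl
map-entry-signs zero    []          ()
map-entry-signs zero    (_ ∷ _ ∷ _) ()
map-entry-signs (suc n) s           p    = begin
  map (entry s) (map (true ∷_) S ++ map (false ∷_) S)                   ≡⟨ map-++ (entry s) (map (true ∷_) S) _ ⟩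
  map (entry s) (map (true ∷_) S) ++ map (entry s) (map (false ∷_) S)  ≡⟨ cong₂ _++_ (on-half true) (on-half false) ⟩
  take (2 ^ n) s ++ drop (2 ^ n) s                                      ≡⟨ take++drop≡id (2 ^ n) s ⟩
  s                                                                     ∎
  where
  S = signs n
  on-half : ∀ x → map (entry s) (map (x ∷_) S) ≡ half x (2 ^ n) s
  on-half x = begin
    map (entry s) (map (x ∷_) S)                     ≡⟨ map-∘ S ⟨
    map (λ k → entry (half x (2 ^ length k) s) k) S  ≡⟨ map-cong-local (All.map (λ {k} → cong (λ m → entry (half x (2 ^ m) s) k)) (signs-length n)) ⟩
    map (entry (half x (2 ^ n) s)) S                 ≡⟨ map-entry-signs n _ (length-half x n s p) ⟩
    half x (2 ^ n) s                                 ∎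

or-select-agree : ∀ k b → length b ≡ 2 ^ length k →
  or (select b (map (λ k′ → agree k′ k) (signs (length k)))) ≡ entry b k
or-select-agree []      (true  ∷ []) refl = refl
or-select-agree []      (false ∷ []) refl = refl
or-select-agree []      []           ()
or-select-agree []      (_ ∷ _ ∷ _)  ()
or-select-agree (x ∷ k) b            p    = begin
  or (select b (map ag (map (true ∷_) S ++ map (false ∷_) S)))
    ≡⟨ cong (or ∘ select b) (map-++ ag (map (true ∷_) S) _) ⟩
  or (select b (row true ++ row false))
    ≡⟨ cong or (select-++ b (row true) (row false) length-row) ⟩
  or (select (take ℓ b) (row true) ++ select (drop ℓ b) (row false))
    ≡⟨ or-++ (select (take ℓ b) (row true)) _ ⟩
  on true ∨ on false
    ≡⟨ cong₂ _∨_ (on≡ true) (on≡ false) ⟩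
  ((true ≡ᵇ x) ∧ entry (take ℓ b) k) ∨ ((false ≡ᵇ x) ∧ entry (drop ℓ b) k)
    ≡⟨ pick x ⟩
  entry b (x ∷ k) ∎
  where
  n = length k
  S = signs n
  ℓ = 2 ^ n
  ag : List Bool → Bool
  ag k′ = agree k′ (x ∷ k)
  row : Bool → List Bool
  row y = map ag (map (y ∷_) S)
  length-row : length (row true) ≡ ℓ
  length-row = trans (length-map ag (map (true ∷_) S)) (trans (length-map (true ∷_) S) (length-signs n))
  on : Bool → Bool
  on y = or (select (half y ℓ b) (row y))
  on≡ : ∀ y → on y ≡ (y ≡ᵇ x) ∧ entry (half y ℓ b) k
  on≡ y = begin
    on y                                                              ≡⟨ cong (or ∘ select (half y ℓ b)) (map-∘ S) ⟨
    or (select (half y ℓ b) (map (λ k′ → (y ≡ᵇ x) ∧ agree k′ k) S))  ≡⟨ or-select-∧ (y ≡ᵇ x) (λ k′ → agree k′ k) _ S ⟩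
    (y ≡ᵇ x) ∧ or (select (half y ℓ b) (map (λ k′ → agree k′ k) S))  ≡⟨ cong ((y ≡ᵇ x) ∧_) (or-select-agree k _ (length-half y n b p)) ⟩
    (y ≡ᵇ x) ∧ entry (half y ℓ b) k                                   ∎
  pick : ∀ x → ((true ≡ᵇ x) ∧ entry (take ℓ b) k) ∨ ((false ≡ᵇ x) ∧ entry (drop ℓ b) k) ≡ entry b (x ∷ k)
  pick true  = ∨-identityʳ _
  pick false = refl

eval-⋀ : ∀ val w φs → eval val w (⋀ φs) ≡ and (map (eval val w) φs)
eval-⋀ val w []           = refl
eval-⋀ val w (φ ∷ [])     = sym (∧-identityʳ _)
eval-⋀ val w (φ ∷ ψ ∷ φs) = cong (eval val w φ ∧_) (eval-⋀ val w (ψ ∷ φs))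

eval-⋁ : ∀ val w φs → eval val w (⋁ φs) ≡ or (map (eval val w) φs)
eval-⋁ val w []           = refl
eval-⋁ val w (φ ∷ [])     = sym (∨-identityʳ _)
eval-⋁ val w (φ ∷ ψ ∷ φs) = cong (eval val w φ ∨_) (eval-⋁ val w (ψ ∷ φs))

eval-lit : ∀ val w x φ → eval val w (lit x φ) ≡ (x ≡ᵇ eval val w φ)
eval-lit val w true  φ = refl
eval-lit val w false φ = refl

and-eval-lits : ∀ val w s φs → and (map (eval val w) (zipWith lit s φs)) ≡ agree s (map (eval val w) φs)
and-eval-lits val w s φs = cong and (map-eval-lits s φs)
  where
  map-eval-lits : ∀ s φs → map (eval val w) (zipWith lit s φs) ≡ zipWith _≡ᵇ_ s (map (eval val w) φs)
  map-eval-lits []      _        = refl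
  map-eval-lits (_ ∷ _) []       = refl
  map-eval-lits (x ∷ s) (φ ∷ φs) = cong₂ _∷_ (eval-lit val w x φ) (map-eval-lits s φs)

module Neighbourhood {W : Set} (N : W → (W → Bool) → Bool)
                     (N-cong : ∀ x {T T′ : W → Bool} → (∀ y → T y ≡ T′ y) → N x T ≡ N x T′) where

  ⟦_⟧ : Formula → (ℕ → W → Bool) → W → Bool
  ⟦ var i ⟧  U x = U i x
  ⟦ ⊥' ⟧     U x = false
  ⟦ ⊤' ⟧     U x = true
  ⟦ ¬' φ ⟧   U x = not (⟦ φ ⟧ U x)
  ⟦ φ ∨' ψ ⟧ U x = ⟦ φ ⟧ U x ∨ ⟦ ψ ⟧ U x
  ⟦ φ ∧' ψ ⟧ U x = ⟦ φ ⟧ U x ∧ ⟦ ψ ⟧ U x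
  ⟦ ◇ φ ⟧    U x = N x (⟦ φ ⟧ U)

  ⟦⟧≡eval : ∀ φ U x → ⟦ φ ⟧ U x ≡ eval (λ i → U i x) (λ ψ → N x (⟦ ψ ⟧ U)) φ
  ⟦⟧≡eval (var i)  U x = refl
  ⟦⟧≡eval ⊥'       U x = refl
  ⟦⟧≡eval ⊤'       U x = refl
  ⟦⟧≡eval (¬' φ)   U x = cong not (⟦⟧≡eval φ U x)
  ⟦⟧≡eval (φ ∨' ψ) U x = cong₂ _∨_ (⟦⟧≡eval φ U x) (⟦⟧≡eval ψ U x)
  ⟦⟧≡eval (φ ∧' ψ) U x = cong₂ _∧_ (⟦⟧≡eval φ U x) (⟦⟧≡eval ψ U x)
  ⟦⟧≡eval (◇ φ)    U x = refl

  ⟦⟧-subst' : ∀ σ φ U x → ⟦ subst' σ φ ⟧ U x ≡ ⟦ φ ⟧ (λ i → ⟦ σ i ⟧ U) x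
  ⟦⟧-subst' σ (var i)  U x = refl
  ⟦⟧-subst' σ ⊥'       U x = refl
  ⟦⟧-subst' σ ⊤'       U x = refl
  ⟦⟧-subst' σ (¬' φ)   U x = cong not (⟦⟧-subst' σ φ U x)
  ⟦⟧-subst' σ (φ ∨' ψ) U x = cong₂ _∨_ (⟦⟧-subst' σ φ U x) (⟦⟧-subst' σ ψ U x)
  ⟦⟧-subst' σ (φ ∧' ψ) U x = cong₂ _∧_ (⟦⟧-subst' σ φ U x) (⟦⟧-subst' σ ψ U x)
  ⟦⟧-subst' σ (◇ φ)    U x = N-cong x (⟦⟧-subst' σ φ U)

  E-sound : ∀ {φ} → E φ → ∀ U x → ⟦ φ ⟧ U x ≡ true
  E-sound (taut {φ} t)      U x = trans (⟦⟧≡eval φ U x) (t _ _)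
  E-sound (mp p q)          U x = modus-ponens _ _ (E-sound p U x) (E-sound q U x)
    where
    modus-ponens : ∀ a b → a ≡ true → not a ∨ b ≡ true → b ≡ true
    modus-ponens true b refl q = q
  E-sound (us {φ} σ p)      U x = trans (⟦⟧-subst' σ φ U x) (E-sound p (λ i → ⟦ σ i ⟧ U) x)
  E-sound (re p)            U x = ≡⇒⇔-true (N-cong x (λ y → ⇔-true⇒≡ _ _ (E-sound p U y)))
    where
    ⇔-true⇒≡ : ∀ a b → (not a ∨ b) ∧ (not b ∨ a) ≡ true → a ≡ b
    ⇔-true⇒≡ true  true  _ = refl
    ⇔-true⇒≡ false false _ = refl
    ⇔-true⇒≡ true  false ()
    ⇔-true⇒≡ false true  ()
    ≡⇒⇔-true : ∀ {a b} → a ≡ b → (not a ∨ b) ∧ (not b ∨ a) ≡ true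
    ≡⇒⇔-true {true}  refl = refl
    ≡⇒⇔-true {false} refl = refl

module Canonical (v : ℕ) where

  values : (ℕ → Bool) → List Bool
  values val = applyUpTo (val ∘ suc) v

  length-values : ∀ val → length (values val) ≡ v
  length-values val = length-applyUpTo (val ∘ suc) v

  arity : ℕ → ℕ
  arity zero    = v
  arity (suc d) = v + length (dcfs v d)

  minterm₀ : List Bool → Formula
  minterm₀ s = ⋀ (zipWith lit s (vars v))

  minterm : ℕ → List Bool → Formula
  minterm zero    s = minterm₀ s
  minterm (suc d) s = ⋀ (minterm₀ (take v s) ∷ zipWith lit (drop v s) (map ◇_ (dcfs v d)))

  profile : ℕ → (ℕ → Bool) → (Formula → Bool) → List Bool
  profile zero    val w = values val
  profile (suc d) val w = values val ++ map w (dcfs v d)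

  length-profile : ∀ d val w → length (profile d val w) ≡ arity d
  length-profile zero    val w = length-values val
  length-profile (suc d) val w =
    trans (length-++ (values val)) (cong₂ _+_ (length-values val) (length-map w (dcfs v d)))

  eval-minterm₀ : ∀ val w s → eval val w (minterm₀ s) ≡ agree s (values val)
  eval-minterm₀ val w s = trans (eval-⋀ val w (zipWith lit s (vars v)))
    (trans (and-eval-lits val w s (vars v)) (cong (agree s) (map-applyUpTo _ (eval val w) v)))

  eval-minterm : ∀ d val w s → eval val w (minterm d s) ≡ agree s (profile d val w)
  eval-minterm zero    val w s = eval-minterm₀ val w s
  eval-minterm (suc d) val w s = begin
    eval val w (minterm (suc d) s)
      ≡⟨ eval-⋀ val w (minterm₀ (take v s) ∷ ◇-lits) ⟩
    eval val w (minterm₀ (take v s)) ∧ and (map (eval val w) ◇-lits)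
      ≡⟨ cong₂ _∧_ (eval-minterm₀ val w (take v s)) (and-eval-lits val w (drop v s) (map ◇_ (dcfs v d))) ⟩
    agree (take v s) (values val) ∧ agree (drop v s) (map (eval val w) (map ◇_ (dcfs v d)))
      ≡⟨ cong (λ ws → agree (take v s) (values val) ∧ agree (drop v s) ws) (map-∘ (dcfs v d)) ⟨
    agree (take v s) (values val) ∧ agree (drop v s) (map w (dcfs v d))
      ≡⟨ cong (λ m → agree (take m s) (values val) ∧ agree (drop m s) (map w (dcfs v d))) (length-values val) ⟨
    agree (take (length (values val)) s) (values val) ∧ agree (drop (length (values val)) s) (map w (dcfs v d))
      ≡⟨ agree-++ s (values val) (map w (dcfs v d)) ⟨
    agree s (profile (suc d) val w) ∎
    where
    ◇-lits = zipWith lit (drop v s) (map ◇_ (dcfs v d))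

  minterm-suc-++ : ∀ d a s → length a ≡ v →
    minterm (suc d) (a ++ s) ≡ ⋀ (minterm₀ a ∷ zipWith lit s (map ◇_ (dcfs v d)))
  minterm-suc-++ d a s refl =
    cong₂ (λ a′ s′ → ⋀ (minterm₀ a′ ∷ zipWith lit s′ (map ◇_ (dcfs v d)))) (take-length-++ a s) (drop-length-++ a s)

  minterms≡ : ∀ d → minterms v d ≡ map (minterm d) (signs (arity d))
  minterms≡ zero    = refl
  minterms≡ (suc d) = begin
    concatMap (λ m₀ → map (conj m₀) (signs n)) (map minterm₀ (signs v))
      ≡⟨ concatMap-map (λ m₀ → map (conj m₀) (signs n)) minterm₀ (signs v) ⟩
    concatMap (λ a → map (conj (minterm₀ a)) (signs n)) (signs v)
      ≡⟨ cong concat (map-cong-local (All.map split (signs-length v))) ⟩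
    concatMap (λ a → map (minterm (suc d)) (map (a ++_) (signs n))) (signs v)
      ≡⟨ map-concatMap (minterm (suc d)) (λ a → map (a ++_) (signs n)) (signs v) ⟨
    map (minterm (suc d)) (concatMap (λ a → map (a ++_) (signs n)) (signs v))
      ≡⟨ cong (map (minterm (suc d))) (signs-+ v n) ⟨
    map (minterm (suc d)) (signs (arity (suc d))) ∎
    where
    n = length (dcfs v d)
    conj : Formula → List Bool → Formula
    conj m₀ s = ⋀ (m₀ ∷ zipWith lit s (map ◇_ (dcfs v d)))
    split : ∀ {a} → length a ≡ v → map (conj (minterm₀ a)) (signs n) ≡ map (minterm (suc d)) (map (a ++_) (signs n))
    split {a} la = trans (map-cong (λ s → sym (minterm-suc-++ d a s la)) (signs n)) (map-∘ (signs n))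

  length-minterms : ∀ d → length (minterms v d) ≡ 2 ^ arity d
  length-minterms d = trans (cong length (minterms≡ d)) (trans (length-map (minterm d) (signs (arity d))) (length-signs (arity d)))

  dcf : ℕ → List Bool → Formula
  dcf d b = ⋁ (select b (minterms v d))

  dcfs≡ : ∀ d → dcfs v d ≡ map (dcf d) (signs (length (minterms v d)))
  dcfs≡ d = trans (cong (map ⋁) (sublists≡map-select (minterms v d))) (sym (map-∘ (signs (length (minterms v d)))))

  length-dcfs : ∀ d → length (dcfs v d) ≡ 2 ^ length (minterms v d)
  length-dcfs d = trans (cong length (dcfs≡ d)) (trans (length-map (dcf d) (signs (length (minterms v d)))) (length-signs (length (minterms v d))))

  ⋁-minterms-tautology : ∀ d → Tautology (⋁ (minterms v d))
  ⋁-minterms-tautology d val w = begin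
    eval val w (⋁ (minterms v d))         ≡⟨ eval-⋁ val w (minterms v d) ⟩
    or (map (eval val w) (minterms v d))  ≡⟨ cong (or ∘ map (eval val w)) (minterms≡ d) ⟩
    or (map (eval val w) ms)              ≡⟨ true∈⇒or true∈ ⟩
    true                                  ∎
    where
    ms = map (minterm d) (signs (arity d))
    p = profile d val w
    p∈ : p ∈ signs (arity d)
    p∈ = subst (λ m → p ∈ signs m) (length-profile d val w) (∈-signs p)
    true∈ : true ∈ map (eval val w) ms
    true∈ = subst (_∈ map (eval val w) ms) (trans (eval-minterm d val w p) (agree-refl p))
      (∈-map⁺ (eval val w) (∈-map⁺ (minterm d) p∈))

  World : Set
  World = ℕ × List Bool

  valuation : ℕ → World → Bool
  valuation zero    _       = false
  valuation (suc i) (_ , k) = bit k i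

  realisers : ℕ → List World
  realisers d = map (d ,_) (signs (arity d))

  -- The world (d + 1 , k) reads the values of ◇ψ, for the DCFs ψ of depth d, off the
  -- tail of k: T is a neighbourhood iff k gives sign true to the DCF whose truth
  -- vector on the realisers of depth d is that of T.
  nbhd : World → (World → Bool) → Bool
  nbhd (zero  , _) T = false
  nbhd (suc d , k) T = entry (drop v k) (map T (realisers d))

  nbhd-cong : ∀ x {T T′ : World → Bool} → (∀ y → T y ≡ T′ y) → nbhd x T ≡ nbhd x T′
  nbhd-cong (zero  , _) _    = refl
  nbhd-cong (suc d , k) T≗T′ = cong (entry (drop v k)) (map-cong T≗T′ (realisers d))

  open Neighbourhood nbhd nbhd-cong

  ◇-values : World → Formula → Bool
  ◇-values x ψ = nbhd x (⟦ ψ ⟧ valuation)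

  mutual
    profile-realiser : ∀ d k → length k ≡ arity d →
      profile d (λ i → valuation i (d , k)) (◇-values (d , k)) ≡ k
    profile-realiser zero    k lk =
      trans (applyUpTo-bit v k (≤-reflexive (sym lk))) (take-all v k (≤-reflexive lk))
    profile-realiser (suc d) k lk = begin
      values (λ i → valuation i (suc d , k)) ++ map (◇-values (suc d , k)) (dcfs v d)
        ≡⟨ cong₂ _++_ (applyUpTo-bit v k (≤-trans (m≤m+n v _) (≤-reflexive (sym lk)))) ◇-part ⟩
      take v k ++ drop v k
        ≡⟨ take++drop≡id v k ⟩
      k ∎
      where
      M = length (minterms v d)
      ◇-part : map (◇-values (suc d , k)) (dcfs v d) ≡ drop v k
      ◇-part = begin
        map (◇-values (suc d , k)) (dcfs v d)
          ≡⟨ cong (map (◇-values (suc d , k))) (dcfs≡ d) ⟩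
        map (◇-values (suc d , k)) (map (dcf d) (signs M))
          ≡⟨ map-∘ (signs M) ⟨
        map (λ b → entry (drop v k) (map (⟦ dcf d b ⟧ valuation) (realisers d))) (signs M)
          ≡⟨ map-cong-local (All.map (λ lb → cong (entry (drop v k)) (truth-vector-dcf d _ (trans lb (length-minterms d)))) (signs-length M)) ⟩
        map (entry (drop v k)) (signs M)
          ≡⟨ map-entry-signs M (drop v k) (trans (length-drop-+ v k lk) (length-dcfs d)) ⟩
        drop v k ∎

    truth-vector-dcf : ∀ d b → length b ≡ 2 ^ arity d → map (⟦ dcf d b ⟧ valuation) (realisers d) ≡ b
    truth-vector-dcf d b lb = begin
      map (⟦ dcf d b ⟧ valuation) (realisers d)    ≡⟨ map-∘ S ⟨
      map (λ k → ⟦ dcf d b ⟧ valuation (d , k)) S  ≡⟨ map-cong-local (All.map (truth-at _) (signs-length (arity d))) ⟩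
      map (entry b) S                              ≡⟨ map-entry-signs (arity d) b lb ⟩
      b                                            ∎
      where
      S = signs (arity d)
      truth-at : ∀ k → length k ≡ arity d → ⟦ dcf d b ⟧ valuation (d , k) ≡ entry b k
      truth-at k lk = begin
        ⟦ dcf d b ⟧ valuation (d , k)
          ≡⟨ ⟦⟧≡eval (dcf d b) valuation (d , k) ⟩
        eval val w (⋁ (select b (minterms v d)))
          ≡⟨ eval-⋁ val w (select b (minterms v d)) ⟩
        or (map (eval val w) (select b (minterms v d)))
          ≡⟨ cong or (map-select (eval val w) b (minterms v d)) ⟩
        or (select b (map (eval val w) (minterms v d)))
          ≡⟨ cong (λ ms → or (select b (map (eval val w) ms))) (minterms≡ d) ⟩
        or (select b (map (eval val w) (map (minterm d) S)))
          ≡⟨ cong (or ∘ select b) (map-∘ S) ⟨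
        or (select b (map (λ k′ → eval val w (minterm d k′)) S))
          ≡⟨ cong (or ∘ select b) (map-cong (λ k′ → trans (eval-minterm d val w k′) (cong (agree k′) (profile-realiser d k lk))) S) ⟩
        or (select b (map (λ k′ → agree k′ k) S))
          ≡⟨ cong (λ m → or (select b (map (λ k′ → agree k′ k) (signs m)))) lk ⟨
        or (select b (map (λ k′ → agree k′ k) (signs (length k))))
          ≡⟨ or-select-agree k b (trans lb (cong (2 ^_) (sym lk))) ⟩
        entry b k ∎
        where
        val = λ i → valuation i (d , k)
        w = ◇-values (d , k)

  E-dcf⇒complete : ∀ d {φ} → φ ∈ dcfs v d → E φ → φ ≡ ⋁ (minterms v d)
  E-dcf⇒complete d φ∈ ⊢φ with ∈-map⁻ (dcf d) (subst (_ ∈_) (dcfs≡ d) φ∈)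
  ... | b , b∈ , refl = cong ⋁ (select-all (minterms v d) b-true lb)
    where
    lb : length b ≡ length (minterms v d)
    lb = All.lookup (signs-length _) b∈
    b-true : All (_≡ true) b
    b-true = subst (All (_≡ true)) (truth-vector-dcf d b (trans lb (length-minterms d)))
      (map⁺ (All.tabulate (λ {x} _ → E-sound ⊢φ valuation x)))

theorem1 : (v d : ℕ) (φ : Formula) → φ ∈ dcfs v d →
    (E φ → φ ≡ ⋁ (minterms v d)) × (φ ≡ ⋁ (minterms v d) → E φ)
theorem1 v d φ φ∈ = E-dcf⇒complete d φ∈ , λ φ≡ → subst E (sym φ≡) (taut (⋁-minterms-tautology d))
  where open Canonical v
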